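{- (i) Let $\Lambda$ be a set of standard formulas of $\mathcal{L}_{\mathtt{CL}}$ closed under standard substitution. If $\mathcal{A}$ is an $\mathtt{inq}\Lambda$-algebra, then $\mathcal{A}\vDash^c\phi$ for every $\phi\in\mathtt{inq}\Lambda$. (ii) Let $\Lambda$ be a set of standard formulas of $\mathcal{L}_{\mathtt{CL}}^{\otimes}$ closed under standard substitution. If $\mathcal{A}$ is an $\mathtt{inq}\Lambda^{\otimes}$-algebra, then $\mathcal{A}\vDash^c\phi$ for every $\phi\in\mathtt{inq}\Lambda^{\otimes}$.
   Context: Fix a countable set $\mathtt{At}$ of propositional variables. Formulas of $\mathcal{L}_{\mathtt{CL}}$ are generated by $\phi::=p\mid\bot\mid\phi\land\phi\mid\phi\lor\phi\mid\phi\to\phi$; formulas of $\mathcal{L}_{\mathtt{CL}}^{\otimes}$ additionally allow $\phi\otimes\phi$. A formula is standard if it contains no $\lor$; a standard substitution replaces atoms by standard formulas. $\mathtt{inqI}$ is the smallest set of $\mathcal{L}_{\mathtt{CL}}$-formulas containing, for all $\phi,\psi,\chi$ and standard $\alpha$: (A1) $\phi\to(\psi\to\phi)$; (A2) $(\phi\to(\psi\to\chi))\to((\phi\to\psi)\to(\phi\to\chi))$; (A3) $\phi\land\psi\to\phi$; (A4) $\phi\land\psi\to\psi$; (A5) $\phi\to(\psi\to\phi\land\psi)$; (A6) $\phi\to\phi\lor\psi$; (A7) $\psi\to\phi\lor\psi$; (A8) $(\phi\to\chi)\to((\psi\to\chi)\to(\phi\lor\psi\to\chi))$; (A9) $\bot\to\phi$;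 (A10) $(\alpha\to(\phi\lor\psi))\to((\alpha\to\phi)\lor(\alpha\to\psi))$; closed under modus ponens. $\mathtt{inq}\Lambda$ is the modus-ponens closure of $\mathtt{inqI}\cup\Lambda$. $\mathtt{inqI}^{\otimes}$ is the smallest set of $\mathcal{L}_{\mathtt{CL}}^{\otimes}$-formulas containing (A1)–(A10) (all formulas of $\mathcal{L}_{\mathtt{CL}}^{\otimes}$, standard $\alpha$) and, for arbitrary $\phi,\psi,\chi,\tau$ and standard $\alpha,\beta,\gamma$: (A11) $\alpha\to(\alpha\otimes\beta)$; (A12) $(\alpha\otimes\beta)\to(\beta\otimes\alpha)$; (A13) $\phi\otimes(\psi\lor\chi)\to(\phi\otimes\psi)\lor(\phi\otimes\chi)$; (A14) $(\phi\to\chi)\to((\psi\to\tau)\to(\phi\otimes\psi\to\chi\otimes\tau))$; (A15) $(\alpha\to\gamma)\to((\beta\to\gamma)\to(\alpha\otimes\beta\to\gamma))$; closed under modus ponens. $\mathtt{inq}\Lambda^{\otimes}$ is the modus-ponens closure of $\mathtt{inqI}^{\otimes}\cup\Lambda$. A Brouwerian semilattice is $(B,\land,\to,0)$ with $(B,\land)$ a meet-semilattice with least element $0$ and $a\land b\le c\iff a\le b\to c$. An inquisitive algebra is a structure $\mathcal{A}=(A,A_c,\land,\lor,\to,0)$ with a unary predicate $A_c\subseteq A$ (the core) such that, with $\langle A_c\rangle$ the closure of $A_c$ under $\land,\lor,\to,0$, $(\langle A_c\rangle,\lor,\land,\to,0)$ is a Heyting algebra; $(A_c,\land,\to,0)$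 is a Brouwerian semilattice; and $a\to(x\lor y)=(a\to x)\lor(a\to y)$ for all $a\in A_c$, $x,y\in\langle A_c\rangle$ (Split). A dependence algebra is $(A,A_c,\land,\otimes,\lor,\to,0)$ with $A_c\subseteq A$ such that, with $\langle A_c\rangle$ the closure under $\lor,\otimes,\land,\to,0$, $(\langle A_c\rangle,\lor,\land,\to,0)$ is a Heyting algebra; $(A_c,\otimes,\land,\to,0)$ is a Heyting algebra; and for $a\in A_c$, $x,y,z,k\in\langle A_c\rangle$: Split, $x\otimes(y\lor z)=(x\otimes y)\lor(x\otimes z)$ (Dist), $(x\to z)\to(y\to k)=(x\otimes y)\to(z\otimes k)$ (Mon). $1:=0\to0$. A core valuation is $\mu:\mathtt{At}\to A_c$, extended homomorphically to formulas ($\bot\mapsto0$). $\mathcal{A}\vDash^c\phi$ means $\phi$ evaluates to $1$ under every core valuation. An $\mathtt{inq}\Lambda$-algebra (resp. $\mathtt{inq}\Lambda^{\otimes}$-algebra) is an inquisitive (resp. dependence) algebra validating every formula of $\Lambda$ in this sense. -}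

module Defs where

open import Level using (Level; _⊔_; suc)
open import Data.Nat using (ℕ)
open import Data.Unit using (⊤)
open import Data.Empty using (⊥)
open import Data.Product using (_×_)
open import Relation.Binary.PropositionalEquality using (_≡_)

infixr 5 _⇒ᶠ_
infixr 6 _∨ᶠ_
infixr 7 _∧ᶠ_ _⊗ᶠ_

data Form : Set where
  atom : ℕ → Form
  ⊥ᶠ   : Form
  _∧ᶠ_ : Form → Form → Form
  _∨ᶠ_ : Form → Form → Form
  _⇒ᶠ_ : Form → Form → Form

data Form⊗ : Set where
  atom : ℕ → Form⊗
  ⊥ᶠ   : Form⊗
  _∧ᶠ_ : Form⊗ → Form⊗ → Form⊗
  _∨ᶠ_ : Form⊗ → Form⊗ → Form⊗
  _⇒ᶠ_ : Form⊗ → Form⊗ → Form⊗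
  _⊗ᶠ_ : Form⊗ → Form⊗ → Form⊗

Standard : Form → Set
Standard (atom _)  = ⊤
Standard ⊥ᶠ        = ⊤
Standard (φ ∧ᶠ ψ)  = Standard φ × Standard ψ
Standard (φ ∨ᶠ ψ)  = ⊥
Standard (φ ⇒ᶠ ψ)  = Standard φ × Standard ψ

Standard⊗ : Form⊗ → Set
Standard⊗ (atom _)  = ⊤
Standard⊗ ⊥ᶠ        = ⊤
Standard⊗ (φ ∧ᶠ ψ)  = Standard⊗ φ × Standard⊗ ψ
Standard⊗ (φ ∨ᶠ ψ)  = ⊥
Standard⊗ (φ ⇒ᶠ ψ)  = Standard⊗ φ × Standard⊗ ψ
Standard⊗ (φ ⊗ᶠ ψ)  = Standard⊗ φ × Standard⊗ ψ

sub : (ℕ → Form) → Form → Form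
sub σ (atom n) = σ n
sub σ ⊥ᶠ       = ⊥ᶠ
sub σ (φ ∧ᶠ ψ) = sub σ φ ∧ᶠ sub σ ψ
sub σ (φ ∨ᶠ ψ) = sub σ φ ∨ᶠ sub σ ψ
sub σ (φ ⇒ᶠ ψ) = sub σ φ ⇒ᶠ sub σ ψ

sub⊗ : (ℕ → Form⊗) → Form⊗ → Form⊗
sub⊗ σ (atom n) = σ n
sub⊗ σ ⊥ᶠ       = ⊥ᶠ
sub⊗ σ (φ ∧ᶠ ψ) = sub⊗ σ φ ∧ᶠ sub⊗ σ ψ
sub⊗ σ (φ ∨ᶠ ψ) = sub⊗ σ φ ∨ᶠ sub⊗ σ ψ
sub⊗ σ (φ ⇒ᶠ ψ) = sub⊗ σ φ ⇒ᶠ sub⊗ σ ψ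
sub⊗ σ (φ ⊗ᶠ ψ) = sub⊗ σ φ ⊗ᶠ sub⊗ σ ψ

AllStandard : ∀ {ℓ} → (Form → Set ℓ) → Set ℓ
AllStandard Λ = ∀ φ → Λ φ → Standard φ

AllStandard⊗ : ∀ {ℓ} → (Form⊗ → Set ℓ) → Set ℓ
AllStandard⊗ Λ = ∀ φ → Λ φ → Standard⊗ φ

ClosedStdSubst : ∀ {ℓ} → (Form → Set ℓ) → Set ℓ
ClosedStdSubst Λ =
  (σ : ℕ → Form) → (∀ n → Standard (σ n)) → ∀ φ → Λ φ → Λ (sub σ φ)

ClosedStdSubst⊗ : ∀ {ℓ} → (Form⊗ → Set ℓ) → Set ℓ
ClosedStdSubst⊗ Λ =
  (σ : ℕ → Form⊗) → (∀ n → Standard⊗ (σ n)) → ∀ φ → Λ φ → Λ (sub⊗ σ φ)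

data InqL {ℓ} (Λ : Form → Set ℓ) : Form → Set ℓ where
  hyp : ∀ {φ} → Λ φ → InqL Λ φ
  A1  : ∀ φ ψ → InqL Λ (φ ⇒ᶠ (ψ ⇒ᶠ φ))
  A2  : ∀ φ ψ χ → InqL Λ ((φ ⇒ᶠ (ψ ⇒ᶠ χ)) ⇒ᶠ ((φ ⇒ᶠ ψ) ⇒ᶠ (φ ⇒ᶠ χ)))
  A3  : ∀ φ ψ → InqL Λ (φ ∧ᶠ ψ ⇒ᶠ φ)
  A4  : ∀ φ ψ → InqL Λ (φ ∧ᶠ ψ ⇒ᶠ ψ)
  A5  : ∀ φ ψ → InqL Λ (φ ⇒ᶠ (ψ ⇒ᶠ φ ∧ᶠ ψ))
  A6  : ∀ φ ψ → InqL Λ (φ ⇒ᶠ φ ∨ᶠ ψ)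
  A7  : ∀ φ ψ → InqL Λ (ψ ⇒ᶠ φ ∨ᶠ ψ)
  A8  : ∀ φ ψ χ → InqL Λ ((φ ⇒ᶠ χ) ⇒ᶠ ((ψ ⇒ᶠ χ) ⇒ᶠ (φ ∨ᶠ ψ ⇒ᶠ χ)))
  A9  : ∀ φ → InqL Λ (⊥ᶠ ⇒ᶠ φ)
  A10 : ∀ α φ ψ → Standard α →
        InqL Λ ((α ⇒ᶠ (φ ∨ᶠ ψ)) ⇒ᶠ ((α ⇒ᶠ φ) ∨ᶠ (α ⇒ᶠ ψ)))
  mp  : ∀ {φ ψ} → InqL Λ (φ ⇒ᶠ ψ) → InqL Λ φ → InqL Λ ψ

data InqL⊗ {ℓ} (Λ : Form⊗ → Set ℓ) : Form⊗ → Set ℓ where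
  hyp : ∀ {φ} → Λ φ → InqL⊗ Λ φ
  A1  : ∀ φ ψ → InqL⊗ Λ (φ ⇒ᶠ (ψ ⇒ᶠ φ))
  A2  : ∀ φ ψ χ → InqL⊗ Λ ((φ ⇒ᶠ (ψ ⇒ᶠ χ)) ⇒ᶠ ((φ ⇒ᶠ ψ) ⇒ᶠ (φ ⇒ᶠ χ)))
  A3  : ∀ φ ψ → InqL⊗ Λ (φ ∧ᶠ ψ ⇒ᶠ φ)
  A4  : ∀ φ ψ → InqL⊗ Λ (φ ∧ᶠ ψ ⇒ᶠ ψ)
  A5  : ∀ φ ψ → InqL⊗ Λ (φ ⇒ᶠ (ψ ⇒ᶠ φ ∧ᶠ ψ))
  A6  : ∀ φ ψ → InqL⊗ Λ (φ ⇒ᶠ φ ∨ᶠ ψ)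
  A7  : ∀ φ ψ → InqL⊗ Λ (ψ ⇒ᶠ φ ∨ᶠ ψ)
  A8  : ∀ φ ψ χ → InqL⊗ Λ ((φ ⇒ᶠ χ) ⇒ᶠ ((ψ ⇒ᶠ χ) ⇒ᶠ (φ ∨ᶠ ψ ⇒ᶠ χ)))
  A9  : ∀ φ → InqL⊗ Λ (⊥ᶠ ⇒ᶠ φ)
  A10 : ∀ α φ ψ → Standard⊗ α →
        InqL⊗ Λ ((α ⇒ᶠ (φ ∨ᶠ ψ)) ⇒ᶠ ((α ⇒ᶠ φ) ∨ᶠ (α ⇒ᶠ ψ)))
  A11 : ∀ α β → Standard⊗ α → Standard⊗ β → InqL⊗ Λ (α ⇒ᶠ (α ⊗ᶠ β))
  A12 : ∀ α β → Standard⊗ α → Standard⊗ β →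
        InqL⊗ Λ ((α ⊗ᶠ β) ⇒ᶠ (β ⊗ᶠ α))
  A13 : ∀ φ ψ χ → InqL⊗ Λ (φ ⊗ᶠ (ψ ∨ᶠ χ) ⇒ᶠ (φ ⊗ᶠ ψ) ∨ᶠ (φ ⊗ᶠ χ))
  A14 : ∀ φ ψ χ τ →
        InqL⊗ Λ ((φ ⇒ᶠ χ) ⇒ᶠ ((ψ ⇒ᶠ τ) ⇒ᶠ (φ ⊗ᶠ ψ ⇒ᶠ χ ⊗ᶠ τ)))
  A15 : ∀ α β γ → Standard⊗ α → Standard⊗ β → Standard⊗ γ →
        InqL⊗ Λ ((α ⇒ᶠ γ) ⇒ᶠ ((β ⇒ᶠ γ) ⇒ᶠ (α ⊗ᶠ β ⇒ᶠ γ)))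
  mp  : ∀ {φ ψ} → InqL⊗ Λ (φ ⇒ᶠ ψ) → InqL⊗ Λ φ → InqL⊗ Λ ψ

-- Algebraic structures on subsets (predicates) of a carrier,
-- with equality being propositional equality on the carrier.

module _ {a : Level} {A : Set a} where

  -- Heyting algebra (S, ∨, ∧, ⇒, 0): S closed under the operations,
  -- (S, ∧, ∨) a lattice, 0 least, and residuation
  -- x ∧ y ≤ z ⇔ x ≤ y ⇒ z, where u ≤ v means u ∧ v ≡ u.
  record IsHeytingOn {ℓ} (S : A → Set ℓ) (_∧_ _∨_ _⇒_ : A → A → A) (𝟘 : A)
         : Set (a ⊔ ℓ) where
    field
      ∧-closed : ∀ {x y} → S x → S y → S (x ∧ y)
      ∨-closed : ∀ {x y} → S x → S y → S (x ∨ y)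
      ⇒-closed : ∀ {x y} → S x → S y → S (x ⇒ y)
      𝟘-closed : S 𝟘
      ∧-comm   : ∀ {x y} → S x → S y → x ∧ y ≡ y ∧ x
      ∧-assoc  : ∀ {x y z} → S x → S y → S z → (x ∧ y) ∧ z ≡ x ∧ (y ∧ z)
      ∨-comm   : ∀ {x y} → S x → S y → x ∨ y ≡ y ∨ x
      ∨-assoc  : ∀ {x y z} → S x → S y → S z → (x ∨ y) ∨ z ≡ x ∨ (y ∨ z)
      ∧-absorbs-∨ : ∀ {x y} → S x → S y → x ∧ (x ∨ y) ≡ x
      ∨-absorbs-∧ : ∀ {x y} → S x → S y → x ∨ (x ∧ y) ≡ x
      𝟘-least  : ∀ {x} → S x → 𝟘 ∧ x ≡ 𝟘
      residuate   : ∀ {x y z} → S x → S y → S z →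
                    (x ∧ y) ∧ z ≡ x ∧ y → x ∧ (y ⇒ z) ≡ x
      unresiduate : ∀ {x y z} → S x → S y → S z →
                    x ∧ (y ⇒ z) ≡ x → (x ∧ y) ∧ z ≡ x ∧ y

  record IsBrouwerianOn {ℓ} (S : A → Set ℓ) (_∧_ _⇒_ : A → A → A) (𝟘 : A)
         : Set (a ⊔ ℓ) where
    field
      ∧-closed : ∀ {x y} → S x → S y → S (x ∧ y)
      ⇒-closed : ∀ {x y} → S x → S y → S (x ⇒ y)
      𝟘-closed : S 𝟘
      ∧-idem   : ∀ {x} → S x → x ∧ x ≡ x
      ∧-comm   : ∀ {x y} → S x → S y → x ∧ y ≡ y ∧ x
      ∧-assoc  : ∀ {x y z} → S x → S y → S z → (x ∧ y) ∧ z ≡ x ∧ (y ∧ z)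
      𝟘-least  : ∀ {x} → S x → 𝟘 ∧ x ≡ 𝟘
      residuate   : ∀ {x y z} → S x → S y → S z →
                    (x ∧ y) ∧ z ≡ x ∧ y → x ∧ (y ⇒ z) ≡ x
      unresiduate : ∀ {x y z} → S x → S y → S z →
                    x ∧ (y ⇒ z) ≡ x → (x ∧ y) ∧ z ≡ x ∧ y

  data Gen {ℓ} (P : A → Set ℓ) (_∧_ _∨_ _⇒_ : A → A → A) (𝟘 : A)
       : A → Set (a ⊔ ℓ) where
    base : ∀ {x} → P x → Gen P _∧_ _∨_ _⇒_ 𝟘 x
    g𝟘   : Gen P _∧_ _∨_ _⇒_ 𝟘 𝟘
    g∧   : ∀ {x y} → Gen P _∧_ _∨_ _⇒_ 𝟘 x → Gen P _∧_ _∨_ _⇒_ 𝟘 y →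
           Gen P _∧_ _∨_ _⇒_ 𝟘 (x ∧ y)
    g∨   : ∀ {x y} → Gen P _∧_ _∨_ _⇒_ 𝟘 x → Gen P _∧_ _∨_ _⇒_ 𝟘 y →
           Gen P _∧_ _∨_ _⇒_ 𝟘 (x ∨ y)
    g⇒   : ∀ {x y} → Gen P _∧_ _∨_ _⇒_ 𝟘 x → Gen P _∧_ _∨_ _⇒_ 𝟘 y →
           Gen P _∧_ _∨_ _⇒_ 𝟘 (x ⇒ y)

  data Gen⊗ {ℓ} (P : A → Set ℓ) (_∧_ _⊗_ _∨_ _⇒_ : A → A → A) (𝟘 : A)
       : A → Set (a ⊔ ℓ) where
    base : ∀ {x} → P x → Gen⊗ P _∧_ _⊗_ _∨_ _⇒_ 𝟘 x
    g𝟘   : Gen⊗ P _∧_ _⊗_ _∨_ _⇒_ 𝟘 𝟘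
    g∧   : ∀ {x y} → Gen⊗ P _∧_ _⊗_ _∨_ _⇒_ 𝟘 x → Gen⊗ P _∧_ _⊗_ _∨_ _⇒_ 𝟘 y →
           Gen⊗ P _∧_ _⊗_ _∨_ _⇒_ 𝟘 (x ∧ y)
    g⊗   : ∀ {x y} → Gen⊗ P _∧_ _⊗_ _∨_ _⇒_ 𝟘 x → Gen⊗ P _∧_ _⊗_ _∨_ _⇒_ 𝟘 y →
           Gen⊗ P _∧_ _⊗_ _∨_ _⇒_ 𝟘 (x ⊗ y)
    g∨   : ∀ {x y} → Gen⊗ P _∧_ _⊗_ _∨_ _⇒_ 𝟘 x → Gen⊗ P _∧_ _⊗_ _∨_ _⇒_ 𝟘 y →
           Gen⊗ P _∧_ _⊗_ _∨_ _⇒_ 𝟘 (x ∨ y)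
    g⇒   : ∀ {x y} → Gen⊗ P _∧_ _⊗_ _∨_ _⇒_ 𝟘 x → Gen⊗ P _∧_ _⊗_ _∨_ _⇒_ 𝟘 y →
           Gen⊗ P _∧_ _⊗_ _∨_ _⇒_ 𝟘 (x ⇒ y)

record InqAlgebra (a : Level) : Set (suc a) where
  infixr 5 _⇒_
  infixr 6 _∨_
  infixr 7 _∧_
  field
    Carrier : Set a
    Core    : Carrier → Set a
    _∧_ _∨_ _⇒_ : Carrier → Carrier → Carrier
    𝟘 : Carrier

  ⟨Core⟩ : Carrier → Set a
  ⟨Core⟩ = Gen Core _∧_ _∨_ _⇒_ 𝟘

  field
    gen-heyting : IsHeytingOn ⟨Core⟩ _∧_ _∨_ _⇒_ 𝟘
    core-brouwerian : IsBrouwerianOn Core _∧_ _⇒_ 𝟘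
    split : ∀ {c x y} → Core c → ⟨Core⟩ x → ⟨Core⟩ y →
            c ⇒ (x ∨ y) ≡ (c ⇒ x) ∨ (c ⇒ y)

  𝟙 : Carrier
  𝟙 = 𝟘 ⇒ 𝟘

  ⟦_⟧ : Form → (ℕ → Carrier) → Carrier
  ⟦ atom n ⟧ μ = μ n
  ⟦ ⊥ᶠ ⟧ μ     = 𝟘
  ⟦ φ ∧ᶠ ψ ⟧ μ = ⟦ φ ⟧ μ ∧ ⟦ ψ ⟧ μ
  ⟦ φ ∨ᶠ ψ ⟧ μ = ⟦ φ ⟧ μ ∨ ⟦ ψ ⟧ μ
  ⟦ φ ⇒ᶠ ψ ⟧ μ = ⟦ φ ⟧ μ ⇒ ⟦ ψ ⟧ μ

  valid : Form → Set a
  valid φ = (μ : ℕ → Carrier) → (∀ n → Core (μ n)) → ⟦ φ ⟧ μ ≡ 𝟙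

_⊨ᶜ_ : ∀ {a} → InqAlgebra a → Form → Set a
A ⊨ᶜ φ = InqAlgebra.valid A φ

IsInqΛAlgebra : ∀ {a ℓ} → (Form → Set ℓ) → InqAlgebra a → Set (a ⊔ ℓ)
IsInqΛAlgebra Λ A = ∀ φ → Λ φ → A ⊨ᶜ φ

record DepAlgebra (a : Level) : Set (suc a) where
  infixr 5 _⇒_
  infixr 6 _∨_
  infixr 7 _∧_ _⊗_
  field
    Carrier : Set a
    Core    : Carrier → Set a
    _∧_ _⊗_ _∨_ _⇒_ : Carrier → Carrier → Carrier
    𝟘 : Carrier

  ⟨Core⟩ : Carrier → Set a
  ⟨Core⟩ = Gen⊗ Core _∧_ _⊗_ _∨_ _⇒_ 𝟘

  field
    gen-heyting  : IsHeytingOn ⟨Core⟩ _∧_ _∨_ _⇒_ 𝟘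
    core-heyting : IsHeytingOn Core _∧_ _⊗_ _⇒_ 𝟘
    split : ∀ {c x y} → Core c → ⟨Core⟩ x → ⟨Core⟩ y →
            c ⇒ (x ∨ y) ≡ (c ⇒ x) ∨ (c ⇒ y)
    dist  : ∀ {x y z} → ⟨Core⟩ x → ⟨Core⟩ y → ⟨Core⟩ z →
            x ⊗ (y ∨ z) ≡ (x ⊗ y) ∨ (x ⊗ z)
    mon   : ∀ {x y z k} → ⟨Core⟩ x → ⟨Core⟩ y → ⟨Core⟩ z → ⟨Core⟩ k →
            ((x ⇒ z) ∧ (y ⇒ k)) ∧ ((x ⊗ y) ⇒ (z ⊗ k)) ≡ (x ⇒ z) ∧ (y ⇒ k)

  𝟙 : Carrier
  𝟙 = 𝟘 ⇒ 𝟘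

  ⟦_⟧ : Form⊗ → (ℕ → Carrier) → Carrier
  ⟦ atom n ⟧ μ = μ n
  ⟦ ⊥ᶠ ⟧ μ     = 𝟘
  ⟦ φ ∧ᶠ ψ ⟧ μ = ⟦ φ ⟧ μ ∧ ⟦ ψ ⟧ μ
  ⟦ φ ∨ᶠ ψ ⟧ μ = ⟦ φ ⟧ μ ∨ ⟦ ψ ⟧ μ
  ⟦ φ ⇒ᶠ ψ ⟧ μ = ⟦ φ ⟧ μ ⇒ ⟦ ψ ⟧ μ
  ⟦ φ ⊗ᶠ ψ ⟧ μ = ⟦ φ ⟧ μ ⊗ ⟦ ψ ⟧ μ

  valid : Form⊗ → Set a
  valid φ = (μ : ℕ → Carrier) → (∀ n → Core (μ n)) → ⟦ φ ⟧ μ ≡ 𝟙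

_⊨ᶜ⊗_ : ∀ {a} → DepAlgebra a → Form⊗ → Set a
A ⊨ᶜ⊗ φ = DepAlgebra.valid A φ

IsInqΛ⊗Algebra : ∀ {a ℓ} → (Form⊗ → Set ℓ) → DepAlgebra a → Set (a ⊔ ℓ)
IsInqΛ⊗Algebra Λ A = ∀ φ → Λ φ → A ⊨ᶜ⊗ φ

-- Writing ≤ for the order of
-- the Heyting algebra ⟨A_c⟩, an implication x ⇒ y evaluates to 1 exactly when
-- x ≤ y, and modus ponens preserves 1. Axioms (A1)–(A9) are then Heyting laws
-- of ⟨A_c⟩, and (A10) is (Split), applicable because a standard formula takes
-- its value in the core A_c. In a dependence algebra the core is a Heyting
-- algebra whose join is ⊗, so (A11) and (A15) are join laws of the core and
-- (A12) is commutativity of that join, while (A13) and (A14) are (Dist) and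
-- (Mon).
module Submission where

open import Defs
open import Level using (Level)
open import Data.Nat using (ℕ)
open import Data.Product using (_×_; _,_)
open import Relation.Binary.PropositionalEquality
  using (_≡_; refl; sym; trans; cong)
open Relation.Binary.PropositionalEquality.≡-Reasoning

module HeytingOnProperties
  {a ℓ : Level} {A : Set a} {S : A → Set ℓ} {_∧_ _∨_ _⇒_ : A → A → A} {𝟘 : A}
  (H : IsHeytingOn S _∧_ _∨_ _⇒_ 𝟘) where

  open IsHeytingOn H

  infix 4 _≤_
  _≤_ : A → A → Set a
  x ≤ y = x ∧ y ≡ x

  𝟙 : A
  𝟙 = 𝟘 ⇒ 𝟘

  𝟙-closed : S 𝟙
  𝟙-closed = ⇒-closed 𝟘-closed 𝟘-closed

  ∧-idem : ∀ {x} → S x → x ∧ x ≡ x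
  ∧-idem {x} sx = begin
    x ∧ x              ≡⟨ cong (x ∧_) (sym (∨-absorbs-∧ sx sx)) ⟩
    x ∧ (x ∨ (x ∧ x))  ≡⟨ ∧-absorbs-∨ sx (∧-closed sx sx) ⟩
    x                  ∎

  ≤-refl : ∀ {x} → S x → x ≤ x
  ≤-refl = ∧-idem

  ≤-trans : ∀ {x y z} → S x → S y → S z → x ≤ y → y ≤ z → x ≤ z
  ≤-trans {x} {y} {z} sx sy sz x≤y y≤z = begin
    x ∧ z        ≡⟨ cong (_∧ z) (sym x≤y) ⟩
    (x ∧ y) ∧ z  ≡⟨ ∧-assoc sx sy sz ⟩
    x ∧ (y ∧ z)  ≡⟨ cong (x ∧_) y≤z ⟩
    x ∧ y        ≡⟨ x≤y ⟩
    x            ∎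

  ≤-antisym : ∀ {x y} → S x → S y → x ≤ y → y ≤ x → x ≡ y
  ≤-antisym sx sy x≤y y≤x = trans (sym x≤y) (trans (∧-comm sx sy) y≤x)

  x∧y≤x : ∀ {x y} → S x → S y → (x ∧ y) ≤ x
  x∧y≤x {x} {y} sx sy = begin
    (x ∧ y) ∧ x  ≡⟨ cong (_∧ x) (∧-comm sx sy) ⟩
    (y ∧ x) ∧ x  ≡⟨ ∧-assoc sy sx sx ⟩
    y ∧ (x ∧ x)  ≡⟨ cong (y ∧_) (∧-idem sx) ⟩
    y ∧ x        ≡⟨ ∧-comm sy sx ⟩
    x ∧ y        ∎

  x∧y≤y : ∀ {x y} → S x → S y → (x ∧ y) ≤ y
  x∧y≤y {x} sx sy = trans (∧-assoc sx sy sy) (cong (x ∧_) (∧-idem sy))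

  ∧-greatest : ∀ {x y z} → S x → S y → S z → z ≤ x → z ≤ y → z ≤ (x ∧ y)
  ∧-greatest {x} {y} {z} sx sy sz z≤x z≤y =
    trans (sym (∧-assoc sz sx sy)) (trans (cong (_∧ y) z≤x) z≤y)

  ∧-swap-≤ : ∀ {x y z} → S x → S y → (x ∧ y) ≤ z → (y ∧ x) ≤ z
  ∧-swap-≤ {x} {y} {z} sx sy xy≤z =
    trans (cong (_∧ z) (∧-comm sy sx)) (trans xy≤z (∧-comm sx sy))

  x≤x∨y : ∀ {x y} → S x → S y → x ≤ (x ∨ y)
  x≤x∨y = ∧-absorbs-∨

  y≤x∨y : ∀ {x y} → S x → S y → y ≤ (x ∨ y)
  y≤x∨y {x} {y} sx sy = trans (cong (y ∧_) (∨-comm sx sy)) (∧-absorbs-∨ sy sx)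

  ≤⇒∨≡ : ∀ {x y} → S x → S y → x ≤ y → (x ∨ y) ≡ y
  ≤⇒∨≡ {x} {y} sx sy x≤y = begin
    x ∨ y        ≡⟨ cong (_∨ y) (sym x≤y) ⟩
    (x ∧ y) ∨ y  ≡⟨ ∨-comm (∧-closed sx sy) sy ⟩
    y ∨ (x ∧ y)  ≡⟨ cong (y ∨_) (∧-comm sx sy) ⟩
    y ∨ (y ∧ x)  ≡⟨ ∨-absorbs-∧ sy sx ⟩
    y            ∎

  ∨-least : ∀ {x y z} → S x → S y → S z → x ≤ z → y ≤ z → (x ∨ y) ≤ z
  ∨-least {x} {y} {z} sx sy sz x≤z y≤z = begin
    (x ∨ y) ∧ z              ≡⟨ cong ((x ∨ y) ∧_) (sym x∨y∨z≡z) ⟩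
    (x ∨ y) ∧ ((x ∨ y) ∨ z)  ≡⟨ ∧-absorbs-∨ (∨-closed sx sy) sz ⟩
    x ∨ y                    ∎
    where
    x∨y∨z≡z : ((x ∨ y) ∨ z) ≡ z
    x∨y∨z≡z = trans (∨-assoc sx sy sz)
                (trans (cong (x ∨_) (≤⇒∨≡ sy sz y≤z)) (≤⇒∨≡ sx sz x≤z))

  ⇒-curry : ∀ {x y z} → S x → S y → S z → (x ∧ y) ≤ z → x ≤ (y ⇒ z)
  ⇒-curry = residuate

  ⇒-uncurry : ∀ {x y z} → S x → S y → S z → x ≤ (y ⇒ z) → (x ∧ y) ≤ z
  ⇒-uncurry = unresiduate

  ⇒-eval : ∀ {x y} → S x → S y → ((x ⇒ y) ∧ x) ≤ y
  ⇒-eval sx sy = ⇒-uncurry (⇒-closed sx sy) sx sy (≤-refl (⇒-closed sx sy))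

  ⇒-app : ∀ {w x y} → S w → S x → S y → w ≤ (x ⇒ y) → w ≤ x → w ≤ y
  ⇒-app sw sx sy w≤x⇒y w≤x =
    ≤-trans sw (∧-closed sx⇒y sx) sy (∧-greatest sx⇒y sx sw w≤x⇒y w≤x) (⇒-eval sx sy)
    where sx⇒y = ⇒-closed sx sy

  x≤𝟙 : ∀ {x} → S x → x ≤ 𝟙
  x≤𝟙 sx = ⇒-curry sx 𝟘-closed 𝟘-closed (x∧y≤y sx 𝟘-closed)

  ≤⇒⇒≡𝟙 : ∀ {x y} → S x → S y → x ≤ y → (x ⇒ y) ≡ 𝟙
  ≤⇒⇒≡𝟙 sx sy x≤y = ≤-antisym (⇒-closed sx sy) 𝟙-closed (x≤𝟙 (⇒-closed sx sy))
    (⇒-curry 𝟙-closed sx sy (≤-trans (∧-closed 𝟙-closed sx) sx sy (x∧y≤y 𝟙-closed sx) x≤y))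

  ≡⇒⇒≡𝟙 : ∀ {x y} → S x → x ≡ y → (x ⇒ y) ≡ 𝟙
  ≡⇒⇒≡𝟙 sx refl = ≤⇒⇒≡𝟙 sx sx (≤-refl sx)

  ⇒-mp-𝟙 : ∀ {x y} → S x → S y → x ≡ 𝟙 → (x ⇒ y) ≡ 𝟙 → y ≡ 𝟙
  ⇒-mp-𝟙 {y = y} sx sy refl x⇒y≡𝟙 = ≤-antisym sy 𝟙-closed (x≤𝟙 sy)
    (⇒-app 𝟙-closed 𝟙-closed sy 𝟙≤𝟙⇒y (≤-refl 𝟙-closed))
    where
    𝟙≤𝟙⇒y : 𝟙 ≤ (𝟙 ⇒ y)
    𝟙≤𝟙⇒y = trans (cong (𝟙 ∧_) x⇒y≡𝟙) (∧-idem 𝟙-closed)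

  K-valid : ∀ {x y} → S x → S y → (x ⇒ (y ⇒ x)) ≡ 𝟙
  K-valid sx sy = ≤⇒⇒≡𝟙 sx (⇒-closed sy sx) (⇒-curry sx sy sx (x∧y≤x sx sy))

  S-valid : ∀ {x y z} → S x → S y → S z →
            ((x ⇒ (y ⇒ z)) ⇒ ((x ⇒ y) ⇒ (x ⇒ z))) ≡ 𝟙
  S-valid sx sy sz = ≤⇒⇒≡𝟙 sp (⇒-closed sq (⇒-closed sx sz))
    (⇒-curry sp sq (⇒-closed sx sz) (⇒-curry spq sx sz
      (⇒-app sw sy sz (⇒-app sw sx (⇒-closed sy sz) w≤p w≤x)
                      (⇒-app sw sx sy w≤q w≤x))))
    where
    sp  = ⇒-closed sx (⇒-closed sy sz)
    sq  = ⇒-closed sx sy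
    spq = ∧-closed sp sq
    sw  = ∧-closed spq sx
    w≤x = x∧y≤y spq sx
    w≤p = ≤-trans sw spq sp (x∧y≤x spq sx) (x∧y≤x sp sq)
    w≤q = ≤-trans sw spq sq (x∧y≤x spq sx) (x∧y≤y sp sq)

  ∧-proj₁-valid : ∀ {x y} → S x → S y → ((x ∧ y) ⇒ x) ≡ 𝟙
  ∧-proj₁-valid sx sy = ≤⇒⇒≡𝟙 (∧-closed sx sy) sx (x∧y≤x sx sy)

  ∧-proj₂-valid : ∀ {x y} → S x → S y → ((x ∧ y) ⇒ y) ≡ 𝟙
  ∧-proj₂-valid sx sy = ≤⇒⇒≡𝟙 (∧-closed sx sy) sy (x∧y≤y sx sy)

  ∧-pair-valid : ∀ {x y} → S x → S y → (x ⇒ (y ⇒ (x ∧ y))) ≡ 𝟙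
  ∧-pair-valid sx sy = ≤⇒⇒≡𝟙 sx (⇒-closed sy sxy) (⇒-curry sx sy sxy (≤-refl sxy))
    where sxy = ∧-closed sx sy

  ∨-inj₁-valid : ∀ {x y} → S x → S y → (x ⇒ (x ∨ y)) ≡ 𝟙
  ∨-inj₁-valid sx sy = ≤⇒⇒≡𝟙 sx (∨-closed sx sy) (x≤x∨y sx sy)

  ∨-inj₂-valid : ∀ {x y} → S x → S y → (y ⇒ (x ∨ y)) ≡ 𝟙
  ∨-inj₂-valid sx sy = ≤⇒⇒≡𝟙 sy (∨-closed sx sy) (y≤x∨y sx sy)

  ∨-case-valid : ∀ {x y z} → S x → S y → S z →
                 ((x ⇒ z) ⇒ ((y ⇒ z) ⇒ ((x ∨ y) ⇒ z))) ≡ 𝟙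
  ∨-case-valid {x} {y} {z} sx sy sz = ≤⇒⇒≡𝟙 sp (⇒-closed sq (⇒-closed sxy sz))
    (⇒-curry sp sq (⇒-closed sxy sz) (⇒-curry spq sxy sz
      (∧-swap-≤ sxy spq (⇒-uncurry sxy spq sz
        (∨-least sx sy (⇒-closed spq sz) (branch sx sp (x∧y≤x sp sq))
                                          (branch sy sq (x∧y≤y sp sq)))))))
    where
    sp  = ⇒-closed sx sz
    sq  = ⇒-closed sy sz
    spq = ∧-closed sp sq
    sxy = ∨-closed sx sy
    branch : ∀ {u} → S u → S (u ⇒ z) →
             ((x ⇒ z) ∧ (y ⇒ z)) ≤ (u ⇒ z) → u ≤ (((x ⇒ z) ∧ (y ⇒ z)) ⇒ z)
    branch su su⇒z pq≤u⇒z = ⇒-curry su spq sz (∧-swap-≤ spq su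
      (⇒-app (∧-closed spq su) su sz
        (≤-trans (∧-closed spq su) spq su⇒z (x∧y≤x spq su) pq≤u⇒z)
        (x∧y≤y spq su)))

  𝟘-elim-valid : ∀ {x} → S x → (𝟘 ⇒ x) ≡ 𝟙
  𝟘-elim-valid sx = ≤⇒⇒≡𝟙 𝟘-closed sx (𝟘-least sx)

module InqSoundness {a ℓ : Level} {Λ : Form → Set ℓ}
  (A : InqAlgebra a) (A⊨Λ : IsInqΛAlgebra Λ A) where

  open InqAlgebra A
  open HeytingOnProperties gen-heyting hiding (𝟙)
  module Core = IsBrouwerianOn core-brouwerian

  module _ {μ : ℕ → Carrier} (μ-core : ∀ n → Core (μ n)) where

    ⟦_⟧∈⟨Core⟩ : ∀ φ → ⟨Core⟩ (⟦ φ ⟧ μ)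
    ⟦ atom n ⟧∈⟨Core⟩ = base (μ-core n)
    ⟦ ⊥ᶠ     ⟧∈⟨Core⟩ = g𝟘
    ⟦ φ ∧ᶠ ψ ⟧∈⟨Core⟩ = g∧ ⟦ φ ⟧∈⟨Core⟩ ⟦ ψ ⟧∈⟨Core⟩
    ⟦ φ ∨ᶠ ψ ⟧∈⟨Core⟩ = g∨ ⟦ φ ⟧∈⟨Core⟩ ⟦ ψ ⟧∈⟨Core⟩
    ⟦ φ ⇒ᶠ ψ ⟧∈⟨Core⟩ = g⇒ ⟦ φ ⟧∈⟨Core⟩ ⟦ ψ ⟧∈⟨Core⟩

    standard⇒⟦⟧∈Core : ∀ {φ} → Standard φ → Core (⟦ φ ⟧ μ)
    standard⇒⟦⟧∈Core {atom n} _         = μ-core n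
    standard⇒⟦⟧∈Core {⊥ᶠ}     _         = Core.𝟘-closed
    standard⇒⟦⟧∈Core {φ ∧ᶠ ψ} (sφ , sψ) =
      Core.∧-closed (standard⇒⟦⟧∈Core sφ) (standard⇒⟦⟧∈Core sψ)
    standard⇒⟦⟧∈Core {φ ⇒ᶠ ψ} (sφ , sψ) =
      Core.⇒-closed (standard⇒⟦⟧∈Core sφ) (standard⇒⟦⟧∈Core sψ)

    sound-at : ∀ {φ} → InqL Λ φ → ⟦ φ ⟧ μ ≡ 𝟙
    sound-at (hyp φ∈Λ)      = A⊨Λ _ φ∈Λ μ μ-core
    sound-at (A1 φ ψ)       = K-valid ⟦ φ ⟧∈⟨Core⟩ ⟦ ψ ⟧∈⟨Core⟩
    sound-at (A2 φ ψ χ)     = S-valid ⟦ φ ⟧∈⟨Core⟩ ⟦ ψ ⟧∈⟨Core⟩ ⟦ χ ⟧∈⟨Core⟩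
    sound-at (A3 φ ψ)       = ∧-proj₁-valid ⟦ φ ⟧∈⟨Core⟩ ⟦ ψ ⟧∈⟨Core⟩
    sound-at (A4 φ ψ)       = ∧-proj₂-valid ⟦ φ ⟧∈⟨Core⟩ ⟦ ψ ⟧∈⟨Core⟩
    sound-at (A5 φ ψ)       = ∧-pair-valid ⟦ φ ⟧∈⟨Core⟩ ⟦ ψ ⟧∈⟨Core⟩
    sound-at (A6 φ ψ)       = ∨-inj₁-valid ⟦ φ ⟧∈⟨Core⟩ ⟦ ψ ⟧∈⟨Core⟩
    sound-at (A7 φ ψ)       = ∨-inj₂-valid ⟦ φ ⟧∈⟨Core⟩ ⟦ ψ ⟧∈⟨Core⟩
    sound-at (A8 φ ψ χ)     = ∨-case-valid ⟦ φ ⟧∈⟨Core⟩ ⟦ ψ ⟧∈⟨Core⟩ ⟦ χ ⟧∈⟨Core⟩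
    sound-at (A9 φ)         = 𝟘-elim-valid ⟦ φ ⟧∈⟨Core⟩
    sound-at (A10 α φ ψ sα) = ≡⇒⇒≡𝟙 ⟦ α ⇒ᶠ (φ ∨ᶠ ψ) ⟧∈⟨Core⟩
      (split (standard⇒⟦⟧∈Core sα) ⟦ φ ⟧∈⟨Core⟩ ⟦ ψ ⟧∈⟨Core⟩)
    sound-at (mp {φ} {ψ} ⊢φ⇒ψ ⊢φ) =
      ⇒-mp-𝟙 ⟦ φ ⟧∈⟨Core⟩ ⟦ ψ ⟧∈⟨Core⟩ (sound-at ⊢φ) (sound-at ⊢φ⇒ψ)

  sound : ∀ {φ} → InqL Λ φ → valid φ
  sound ⊢φ μ μ-core = sound-at μ-core ⊢φ

module DepSoundness {a ℓ : Level} {Λ : Form⊗ → Set ℓ}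
  (A : DepAlgebra a) (A⊨Λ : IsInqΛ⊗Algebra Λ A) where

  open DepAlgebra A
  open HeytingOnProperties gen-heyting hiding (𝟙)
  module Core = IsHeytingOn core-heyting
  module CoreProperties = HeytingOnProperties core-heyting

  module _ {μ : ℕ → Carrier} (μ-core : ∀ n → Core (μ n)) where

    ⟦_⟧∈⟨Core⟩ : ∀ φ → ⟨Core⟩ (⟦ φ ⟧ μ)
    ⟦ atom n ⟧∈⟨Core⟩ = base (μ-core n)
    ⟦ ⊥ᶠ     ⟧∈⟨Core⟩ = g𝟘
    ⟦ φ ∧ᶠ ψ ⟧∈⟨Core⟩ = g∧ ⟦ φ ⟧∈⟨Core⟩ ⟦ ψ ⟧∈⟨Core⟩
    ⟦ φ ∨ᶠ ψ ⟧∈⟨Core⟩ = g∨ ⟦ φ ⟧∈⟨Core⟩ ⟦ ψ ⟧∈⟨Core⟩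
    ⟦ φ ⇒ᶠ ψ ⟧∈⟨Core⟩ = g⇒ ⟦ φ ⟧∈⟨Core⟩ ⟦ ψ ⟧∈⟨Core⟩
    ⟦ φ ⊗ᶠ ψ ⟧∈⟨Core⟩ = g⊗ ⟦ φ ⟧∈⟨Core⟩ ⟦ ψ ⟧∈⟨Core⟩

    standard⇒⟦⟧∈Core : ∀ {φ} → Standard⊗ φ → Core (⟦ φ ⟧ μ)
    standard⇒⟦⟧∈Core {atom n} _         = μ-core n
    standard⇒⟦⟧∈Core {⊥ᶠ}     _         = Core.𝟘-closed
    standard⇒⟦⟧∈Core {φ ∧ᶠ ψ} (sφ , sψ) =
      Core.∧-closed (standard⇒⟦⟧∈Core sφ) (standard⇒⟦⟧∈Core sψ)
    standard⇒⟦⟧∈Core {φ ⇒ᶠ ψ} (sφ , sψ) =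
      Core.⇒-closed (standard⇒⟦⟧∈Core sφ) (standard⇒⟦⟧∈Core sψ)
    standard⇒⟦⟧∈Core {φ ⊗ᶠ ψ} (sφ , sψ) =
      Core.∨-closed (standard⇒⟦⟧∈Core sφ) (standard⇒⟦⟧∈Core sψ)

    sound-at : ∀ {φ} → InqL⊗ Λ φ → ⟦ φ ⟧ μ ≡ 𝟙
    sound-at (hyp φ∈Λ)      = A⊨Λ _ φ∈Λ μ μ-core
    sound-at (A1 φ ψ)       = K-valid ⟦ φ ⟧∈⟨Core⟩ ⟦ ψ ⟧∈⟨Core⟩
    sound-at (A2 φ ψ χ)     = S-valid ⟦ φ ⟧∈⟨Core⟩ ⟦ ψ ⟧∈⟨Core⟩ ⟦ χ ⟧∈⟨Core⟩
    sound-at (A3 φ ψ)       = ∧-proj₁-valid ⟦ φ ⟧∈⟨Core⟩ ⟦ ψ ⟧∈⟨Core⟩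
    sound-at (A4 φ ψ)       = ∧-proj₂-valid ⟦ φ ⟧∈⟨Core⟩ ⟦ ψ ⟧∈⟨Core⟩
    sound-at (A5 φ ψ)       = ∧-pair-valid ⟦ φ ⟧∈⟨Core⟩ ⟦ ψ ⟧∈⟨Core⟩
    sound-at (A6 φ ψ)       = ∨-inj₁-valid ⟦ φ ⟧∈⟨Core⟩ ⟦ ψ ⟧∈⟨Core⟩
    sound-at (A7 φ ψ)       = ∨-inj₂-valid ⟦ φ ⟧∈⟨Core⟩ ⟦ ψ ⟧∈⟨Core⟩
    sound-at (A8 φ ψ χ)     = ∨-case-valid ⟦ φ ⟧∈⟨Core⟩ ⟦ ψ ⟧∈⟨Core⟩ ⟦ χ ⟧∈⟨Core⟩
    sound-at (A9 φ)         = 𝟘-elim-valid ⟦ φ ⟧∈⟨Core⟩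
    sound-at (A10 α φ ψ sα) = ≡⇒⇒≡𝟙 ⟦ α ⇒ᶠ (φ ∨ᶠ ψ) ⟧∈⟨Core⟩
      (split (standard⇒⟦⟧∈Core sα) ⟦ φ ⟧∈⟨Core⟩ ⟦ ψ ⟧∈⟨Core⟩)
    sound-at (A11 α β sα sβ) =
      CoreProperties.∨-inj₁-valid (standard⇒⟦⟧∈Core sα) (standard⇒⟦⟧∈Core sβ)
    sound-at (A12 α β sα sβ) = ≡⇒⇒≡𝟙 ⟦ α ⊗ᶠ β ⟧∈⟨Core⟩
      (Core.∨-comm (standard⇒⟦⟧∈Core sα) (standard⇒⟦⟧∈Core sβ))
    sound-at (A13 φ ψ χ)    = ≡⇒⇒≡𝟙 ⟦ φ ⊗ᶠ (ψ ∨ᶠ χ) ⟧∈⟨Core⟩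
      (dist ⟦ φ ⟧∈⟨Core⟩ ⟦ ψ ⟧∈⟨Core⟩ ⟦ χ ⟧∈⟨Core⟩)
    sound-at (A14 φ ψ χ τ)  =
      ≤⇒⇒≡𝟙 ⟦ φ ⇒ᶠ χ ⟧∈⟨Core⟩ ⟦ (ψ ⇒ᶠ τ) ⇒ᶠ (φ ⊗ᶠ ψ ⇒ᶠ χ ⊗ᶠ τ) ⟧∈⟨Core⟩
      (⇒-curry ⟦ φ ⇒ᶠ χ ⟧∈⟨Core⟩ ⟦ ψ ⇒ᶠ τ ⟧∈⟨Core⟩ ⟦ φ ⊗ᶠ ψ ⇒ᶠ χ ⊗ᶠ τ ⟧∈⟨Core⟩
        (mon ⟦ φ ⟧∈⟨Core⟩ ⟦ ψ ⟧∈⟨Core⟩ ⟦ χ ⟧∈⟨Core⟩ ⟦ τ ⟧∈⟨Core⟩))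
    sound-at (A15 α β γ sα sβ sγ) = CoreProperties.∨-case-valid
      (standard⇒⟦⟧∈Core sα) (standard⇒⟦⟧∈Core sβ) (standard⇒⟦⟧∈Core sγ)
    sound-at (mp {φ} {ψ} ⊢φ⇒ψ ⊢φ) =
      ⇒-mp-𝟙 ⟦ φ ⟧∈⟨Core⟩ ⟦ ψ ⟧∈⟨Core⟩ (sound-at ⊢φ) (sound-at ⊢φ⇒ψ)

  sound : ∀ {φ} → InqL⊗ Λ φ → valid φ
  sound ⊢φ μ μ-core = sound-at μ-core ⊢φ

proposition2p8 : {a ℓ : Level} →
    ((Λ : Form → Set ℓ) → AllStandard Λ → ClosedStdSubst Λ →
      (A : InqAlgebra a) → IsInqΛAlgebra Λ A →
      ∀ φ → InqL Λ φ → A ⊨ᶜ φ)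
    ×
    ((Λ : Form⊗ → Set ℓ) → AllStandard⊗ Λ → ClosedStdSubst⊗ Λ →
      (A : DepAlgebra a) → IsInqΛ⊗Algebra Λ A →
      ∀ φ → InqL⊗ Λ φ → A ⊨ᶜ⊗ φ)
proposition2p8 =
    (λ _ _ _ A A⊨Λ _ ⊢φ → InqSoundness.sound A A⊨Λ ⊢φ)
  , (λ _ _ _ A A⊨Λ _ ⊢φ → DepSoundness.sound A A⊨Λ ⊢φ)
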